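{- Let $G$ be a connected graph that is not a star (i.e. not isomorphic to $K_{1,k}$ for any $k\ge 0$). If $A\subseteq E(G)$ satisfies $|A|\ge |E(G)|-1$, then $\iota(G_A)\ge \iota(G)+1$.
   Context: For a graph $G$ and $D\subseteq V(G)$, $N[D]$ is the set of vertices in $D$ together with all their neighbours. $D$ is an isolating set of $G$ if the graph $G-N[D]$ has no edges; the isolation number $\iota(G)$ is the minimum size of an isolating set of $G$. For $A\subseteq E(G)$, $G_A$ denotes the graph obtained from $G$ by subdividing every edge of $A$ exactly once (an edge $uv$ is replaced by a path $u w v$ through a new vertex $w$). -}

module Defs where

open import Data.Nat using (ℕ; zero; suc; _+_)
open import Data.Fin using (Fin; zero; suc; _<_; _↑ˡ_; _↑ʳ_)
open import Data.Fin.Properties using (_≟_)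
open import Data.Fin.Subset using (Subset; ∣_∣) renaming (_∈_ to _∈ₛ_)
open import Data.List using (List; []; _∷_; length; map; filter; concatMap; allFin; lookup; _++_)
open import Data.List.Membership.Propositional using (_∈_)
open import Data.List.Relation.Unary.All using (All)
open import Data.List.Relation.Unary.Unique.Propositional using (Unique)
open import Data.Product using (Σ; ∃; _×_; _,_)
open import Data.Product.Properties using (≡-dec)
open import Data.Sum using (_⊎_)
open import Data.Nat using (_≤_)
open import Function.Bundles using (_↔_; Inverse)
open import Relation.Nullary using (¬?)
import Data.List.Membership.DecPropositional as DecMem

record Graph : Set where
  constructor graph
  field
    n     : ℕ
    edges : List (Fin n × Fin n)
open Graph public

Edge : Graph → Set
Edge G = Fin (n G) × Fin (n G)

-- Well-formedness of a finite simple graph: every edge (u , v) has u < v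
-- (so no loops and each unordered pair has one representation) and no
-- edge is listed twice.  Then |E(G)| = length (edges G).
SimpleGraph : Graph → Set
SimpleGraph G = All (λ e → Data.Product.proj₁ e < Data.Product.proj₂ e) (edges G) × Unique (edges G)

Adj : (G : Graph) → Fin (n G) → Fin (n G) → Set
Adj G u v = ((u , v) ∈ edges G) ⊎ ((v , u) ∈ edges G)

data Reach (G : Graph) : Fin (n G) → Fin (n G) → Set where
  here : ∀ {u} → Reach G u u
  step : ∀ {u v w} → Adj G u v → Reach G v w → Reach G u w

-- connected graphs are nonempty
Connected : Graph → Set
Connected G = Σ (Fin (n G)) (λ _ → ∀ u v → Reach G u v)

star : ℕ → Graph
star k = graph (suc k) (map (λ i → (zero , suc i)) (allFin k))

Isomorphic : Graph → Graph → Set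
Isomorphic G H = Σ (Fin (n G) ↔ Fin (n H)) (λ f →
  ∀ u v → (Adj G u v → Adj H (Inverse.to f u) (Inverse.to f v))
        × (Adj H (Inverse.to f u) (Inverse.to f v) → Adj G u v))

IsStar : Graph → Set
IsStar G = ∃ λ k → Isomorphic G (star k)

InN[_] : (G : Graph) → Subset (n G) → Fin (n G) → Set
InN[ G ] D v = (v ∈ₛ D) ⊎ Σ (Fin (n G)) (λ u → (u ∈ₛ D) × Adj G u v)

Isolating : (G : Graph) → Subset (n G) → Set
Isolating G D = ∀ u v → Adj G u v → InN[ G ] D u ⊎ InN[ G ] D v

IsIsolationNumber : Graph → ℕ → Set
IsIsolationNumber G k =
  Σ (Subset (n G)) (λ D → Isolating G D × ∣ D ∣ ≡ k)
  × (∀ D → Isolating G D → k ≤ ∣ D ∣)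
  where open import Relation.Binary.PropositionalEquality using (_≡_)

-- subdivision G_A: the k-th edge (u , v) of A is replaced by the path
-- u - w_k - v, where w_k is the new vertex  n + k.
subdivide : (G : Graph) → List (Edge G) → Graph
subdivide G A = graph (n G + length A) (kept ++ new)
  where
    open DecMem (≡-dec _≟_ _≟_) using (_∈?_)
    emb : Fin (n G) → Fin (n G + length A)
    emb x = x ↑ˡ length A
    kept = map (λ e → (emb (Data.Product.proj₁ e) , emb (Data.Product.proj₂ e)))
               (filter (λ e → ¬? (e ∈? A)) (edges G))
    new = concatMap (λ k → let e = lookup A k ; w = n G ↑ʳ k in
                             (emb (Data.Product.proj₁ e) , w) ∷ (emb (Data.Product.proj₂ e) , w) ∷ [])
                    (allFin (length A))

module Submission where

-- Let D be an isolating set of G_A. A vertex of G_A stands for its shadow in G: an original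
-- vertex for itself, a subdivision vertex for both ends of its edge. Since at most one edge of G
-- is left unsubdivided, the shadows of the vertices of D meet every edge of G, so sending each
-- vertex of D to a vertex dominating its shadow gives an isolating set of G with at most |D|
-- vertices. One vertex is saved by an exchange: drop some d ∈ D and redirect one other vertex of
-- D, so that every vertex in the shadow of d is still dominated or has all its neighbours
-- dominated. Without subdivision vertices in D, two vertices of D with a common closed neighbour
-- are merged, and if there are none G is a star. If the midpoint of an edge xy lies in D, it is
-- dropped unless both x and y are private to it; then a neighbour z of x or y outside the edge,
-- which exists as G is not a star, yields the exchange according to how z is dominated in G_A,
-- and if no such z is dominated, the unsubdivided edge is yz and either a neighbour of z lies in
-- D or G is the path x y z.

open import Defs
open import Data.Nat using (ℕ; zero; suc; _+_; _≤_; _<_; z≤n; s≤s)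
import Data.Nat.Properties as ℕ
open import Data.Fin using (Fin; zero; suc; splitAt; join)
import Data.Fin.Properties as Fin
open import Data.Fin.Subset using (Subset; ∣_∣; ⁅_⁆; _∪_; _-_; inside; outside) renaming (⊥ to ∅; _∈_ to _∈ₛ_)
import Data.Fin.Subset.Properties as Subset
open import Data.Fin.Permutation using (Permutation; _⟨$⟩ʳ_; _⟨$⟩ˡ_; inverseˡ; inverseʳ; transpose)
open import Data.Vec using ([]; _∷_)
open import Data.List using (List; []; _∷_; length; lookup; _++_; map; filter; concatMap; allFin)
open import Data.List.Membership.Propositional using (_∈_; _∉_; lose)
import Data.List.Membership.Propositional.Properties as ∈
open import Data.List.Relation.Unary.All as All using (All; []; _∷_)
open import Data.List.Relation.Unary.Any as Any using (here; there)
import Data.List.Relation.Unary.Any.Properties as Any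
open import Data.List.Relation.Unary.Unique.Propositional using (Unique)
open import Data.List.Relation.Unary.AllPairs using ([]; _∷_)
import Data.List.Membership.DecPropositional as DecMembership
import Data.List.Properties as List
open import Data.Product using (Σ; _×_; _,_; proj₁; proj₂)
open import Data.Product.Properties using (≡-dec)
open import Data.Sum using (_⊎_; inj₁; inj₂; [_,_])
import Data.Sum as Sum
import Data.Sum.Properties as Sum
open import Data.Empty using (⊥-elim)
open import Function using (_∘_)
open import Relation.Nullary using (¬_; Dec; yes; no; ¬?)
open import Relation.Nullary.Decidable using (_⊎-dec_; _×-dec_; decidable-stable)
open import Relation.Unary using (Decidable)
open import Relation.Binary.PropositionalEquality using (_≡_; _≢_; refl; sym; trans; cong; subst)

module _ {X : Set} where

  private
    ∈-skip : ∀ {y x : X} ys {zs} → y ∈ ys ++ x ∷ zs → y ≢ x → y ∈ ys ++ zs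
    ∈-skip []       (here y≡x)  y≢x = ⊥-elim (y≢x y≡x)
    ∈-skip []       (there y∈)  _   = y∈
    ∈-skip (_ ∷ ys) (here y≡w)  _   = here y≡w
    ∈-skip (_ ∷ ys) (there y∈)  y≢x = there (∈-skip ys y∈ y≢x)

  Unique∧⊆⇒length≤ : ∀ {xs ys : List X} → Unique xs → All (_∈ ys) xs → length xs ≤ length ys
  Unique∧⊆⇒length≤ {[]}     _          _           = z≤n
  Unique∧⊆⇒length≤ {x ∷ xs} (x∉xs ∷ u) (x∈ys ∷ xs⊆ys) with ∈.∈-∃++ x∈ys
  ... | ys₁ , ys₂ , refl =
    subst (suc (length xs) ≤_) (sym (List.length-++-sucʳ ys₁ x ys₂))
      (s≤s (Unique∧⊆⇒length≤ u (All.zipWith (λ (y∈ , x≢y) → ∈-skip ys₁ y∈ (x≢y ∘ sym)) (xs⊆ys , x∉xs))))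

∣p∪q∣≤∣p∣+∣q∣ : ∀ {n} (p q : Subset n) → ∣ p ∪ q ∣ ≤ ∣ p ∣ + ∣ q ∣
∣p∪q∣≤∣p∣+∣q∣ []            []            = z≤n
∣p∪q∣≤∣p∣+∣q∣ (inside ∷ p)  (inside ∷ q)  = s≤s (ℕ.≤-trans (∣p∪q∣≤∣p∣+∣q∣ p q) (ℕ.+-monoʳ-≤ ∣ p ∣ (ℕ.n≤1+n _)))
∣p∪q∣≤∣p∣+∣q∣ (inside ∷ p)  (outside ∷ q) = s≤s (∣p∪q∣≤∣p∣+∣q∣ p q)
∣p∪q∣≤∣p∣+∣q∣ (outside ∷ p) (inside ∷ q)  = subst (suc ∣ p ∪ q ∣ ≤_) (sym (ℕ.+-suc ∣ p ∣ ∣ q ∣)) (s≤s (∣p∪q∣≤∣p∣+∣q∣ p q))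
∣p∪q∣≤∣p∣+∣q∣ (outside ∷ p) (outside ∷ q) = ∣p∪q∣≤∣p∣+∣q∣ p q

image : ∀ {k n} → (Fin k → Fin n) → Subset k → Subset n
image f []            = ∅
image f (inside ∷ p)  = ⁅ f zero ⁆ ∪ image (f ∘ suc) p
image f (outside ∷ p) = image (f ∘ suc) p

∣image∣≤ : ∀ {k n} (f : Fin k → Fin n) p → ∣ image f p ∣ ≤ ∣ p ∣
∣image∣≤ {n = n} f [] = ℕ.≤-reflexive (Subset.∣⊥∣≡0 n)
∣image∣≤ f (inside ∷ p) = begin
  ∣ ⁅ f zero ⁆ ∪ image (f ∘ suc) p ∣      ≤⟨ ∣p∪q∣≤∣p∣+∣q∣ ⁅ f zero ⁆ (image (f ∘ suc) p) ⟩
  ∣ ⁅ f zero ⁆ ∣ + ∣ image (f ∘ suc) p ∣  ≡⟨ cong (_+ ∣ image (f ∘ suc) p ∣) (Subset.∣⁅x⁆∣≡1 (f zero)) ⟩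
  suc ∣ image (f ∘ suc) p ∣               ≤⟨ s≤s (∣image∣≤ (f ∘ suc) p) ⟩
  suc ∣ p ∣                               ∎
  where open ℕ.≤-Reasoning
∣image∣≤ f (outside ∷ p) = ∣image∣≤ (f ∘ suc) p

∈image : ∀ {k n} (f : Fin k → Fin n) p {x} → x ∈ₛ p → f x ∈ₛ image f p
∈image f (inside ∷ p)  Data.Vec.here        = Subset.x∈p∪q⁺ (inj₁ (Subset.x∈⁅x⁆ (f zero)))
∈image f (inside ∷ p)  (Data.Vec.there x∈p) = Subset.x∈p∪q⁺ (inj₂ (∈image (f ∘ suc) p x∈p))
∈image f (outside ∷ p) (Data.Vec.there x∈p) = ∈image (f ∘ suc) p x∈p

module GraphTheory (G : Graph) where

  V : Set
  V = Fin (n G)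

  infix 4 _∈N[_]
  _∈N[_] : V → V → Set
  a ∈N[ t ] = t ≡ a ⊎ Adj G t a

  Adj-sym : ∀ {a b} → Adj G a b → Adj G b a
  Adj-sym (inj₁ ab∈E) = inj₂ ab∈E
  Adj-sym (inj₂ ba∈E) = inj₁ ba∈E

  Adj-irrefl : SimpleGraph G → ∀ {a b} → Adj G a b → a ≢ b
  Adj-irrefl (ordered , _) (inj₁ ab∈E)     = Fin.<⇒≢ (All.lookup ordered ab∈E)
  Adj-irrefl (ordered , _) (inj₂ ba∈E) a≡b = Fin.<⇒≢ (All.lookup ordered ba∈E) (sym a≡b)

  ∈N-sym : ∀ {a t} → a ∈N[ t ] → t ∈N[ a ]
  ∈N-sym (inj₁ t≡a) = inj₁ (sym t≡a)
  ∈N-sym (inj₂ t~a) = inj₂ (Adj-sym t~a)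

  open DecMembership (≡-dec (Fin._≟_ {n G}) (Fin._≟_ {n G})) using (_∈?_) public

  Adj? : ∀ a b → Dec (Adj G a b)
  Adj? a b = ((a , b) ∈? edges G) ⊎-dec ((b , a) ∈? edges G)

  _∈N?[_] : ∀ a t → Dec (a ∈N[ t ])
  a ∈N?[ t ] = (t Fin.≟ a) ⊎-dec Adj? t a

  connected-closed : Connected G → (P : V → Set) → ∀ {c} → P c →
                     (∀ {a b} → P a → Adj G a b → P b) → ∀ v → P v
  connected-closed (_ , reach) P {c} Pc closed v = walk (reach c v) Pc
    where
    walk : ∀ {a b} → Reach G a b → P a → P b
    walk here         Pa = Pa
    walk (step a~ r) Pa = walk r (closed Pa a~)

  centre-adjacent : Connected G → ∀ c → (∀ {a b} → Adj G a b → a ≡ c ⊎ b ≡ c) →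
                    ∀ {v} → v ≢ c → Adj G c v
  centre-adjacent conn c through {v} v≢c =
    Sum.fromInj₂ (⊥-elim ∘ v≢c) (connected-closed conn (λ w → w ≡ c ⊎ Adj G c w) (inj₁ refl) closed v)
    where
    closed : ∀ {a b} → a ≡ c ⊎ Adj G c a → Adj G a b → b ≡ c ⊎ Adj G c b
    closed (inj₁ refl) a~b = inj₂ a~b
    closed (inj₂ c~a)  a~b with through a~b
    ... | inj₁ refl = inj₂ a~b
    ... | inj₂ b≡c  = inj₁ b≡c

star-edge : ∀ {k a b} → (a , b) ∈ edges (star k) → a ≡ zero × b ≢ zero
star-edge {k} ab∈E with ∈.∈-map⁻ (λ i → (zero , suc i)) ab∈E
... | _ , _ , refl = refl , λ ()

star-adjacent : ∀ {k} {b : Fin (suc k)} → b ≢ zero → Adj (star k) zero b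
star-adjacent {b = zero}  b≢0 = ⊥-elim (b≢0 refl)
star-adjacent {b = suc i} _   = inj₁ (∈.∈-map⁺ (λ i → (zero , suc i)) (∈.∈-allFin i))

star-of-centre : ∀ {G} → SimpleGraph G → Connected G → ∀ c →
                 (∀ {a b} → Adj G a b → a ≡ c ⊎ b ≡ c) → IsStar G
star-of-centre {graph zero _} _ _ () _
star-of-centre {G@(graph (suc k) _)} sg conn c through = k , π , λ u v → to-star u v , from-star u v
  where
  open GraphTheory G
  π : Permutation (suc k) (suc k)
  π = transpose c zero

  π[c]≡0 : π ⟨$⟩ʳ c ≡ zero
  π[c]≡0 = inverseʳ π

  π[u]≡0⇒u≡c : ∀ {u} → π ⟨$⟩ʳ u ≡ zero → u ≡ c
  π[u]≡0⇒u≡c eq = trans (sym (inverseˡ π)) (cong (π ⟨$⟩ˡ_) eq)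

  π[v]≢0 : ∀ {u v} → Adj G u v → u ≡ c → π ⟨$⟩ʳ v ≢ zero
  π[v]≢0 u~v refl π[v]≡0 = Adj-irrefl sg u~v (sym (π[u]≡0⇒u≡c π[v]≡0))

  to-star : ∀ u v → Adj G u v → Adj (star k) (π ⟨$⟩ʳ u) (π ⟨$⟩ʳ v)
  to-star u v u~v with through u~v
  ... | inj₁ refl = subst (λ w → Adj (star k) w (π ⟨$⟩ʳ v)) (sym π[c]≡0) (star-adjacent (π[v]≢0 u~v refl))
  ... | inj₂ refl = subst (λ w → Adj (star k) (π ⟨$⟩ʳ u) w) (sym π[c]≡0)
                      (GraphTheory.Adj-sym (star k) (star-adjacent (π[v]≢0 (Adj-sym u~v) refl)))

  from-star : ∀ u v → Adj (star k) (π ⟨$⟩ʳ u) (π ⟨$⟩ʳ v) → Adj G u v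
  from-star u v (inj₁ e) with star-edge e
  ... | π[u]≡0 , π[v]≢0 with π[u]≡0⇒u≡c {u} π[u]≡0
  ... | refl = centre-adjacent conn c through λ { refl → π[v]≢0 π[c]≡0 }
  from-star u v (inj₂ e) with star-edge e
  ... | π[v]≡0 , π[u]≢0 with π[u]≡0⇒u≡c {v} π[v]≡0
  ... | refl = Adj-sym (centre-adjacent conn c through λ { refl → π[u]≢0 π[c]≡0 })

module _ {G : Graph} (sg : SimpleGraph G) (conn : Connected G) where
  open GraphTheory G

  star-of-closed : (P : V → Set) → ∀ {c} → P c →
                   (∀ {a b} → P a → Adj G a b → P b × (a ≡ c ⊎ b ≡ c)) → IsStar G
  star-of-closed P {c} Pc closed = star-of-centre sg conn c λ {a} a~b → proj₂ (closed (everywhere a) a~b)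
    where
    everywhere : ∀ v → P v
    everywhere = connected-closed conn P Pc (λ Pa a~b → proj₁ (closed Pa a~b))

  star-of-packing-vertex-cover : (X : V → Set) → Decidable X → (∀ {a b} → Adj G a b → X a ⊎ X b) →
                      (∀ {x₁ x₂ y} → X x₁ → X x₂ → x₁ ∈N[ y ] → x₂ ∈N[ y ] → x₁ ≡ x₂) → IsStar G
  star-of-packing-vertex-cover X X? cover packing with Fin.any? X?
  ... | no ∄X = star-of-centre sg conn (proj₁ conn) λ a~b →
                  ⊥-elim ([ (λ Xa → ∄X (_ , Xa)) , (λ Xb → ∄X (_ , Xb)) ] (cover a~b))
  ... | yes (x , Xx) = star-of-closed (_∈N[ x ]) (inj₁ refl) closed
    where
    closed : ∀ {a b} → a ∈N[ x ] → Adj G a b → b ∈N[ x ] × (a ≡ x ⊎ b ≡ x)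
    closed a∈N[x] a~b with cover a~b
    ... | inj₁ Xa with packing Xa Xx (inj₁ refl) (∈N-sym a∈N[x])
    ...   | refl = inj₂ a~b , inj₁ refl
    closed a∈N[x] a~b | inj₂ Xb with packing Xb Xx (inj₂ a~b) (∈N-sym a∈N[x])
    ...   | refl = inj₁ refl , inj₂ refl

module Subdivision (G : Graph) (A : List (Edge G)) where
  open GraphTheory G

  m : ℕ
  m = length A

  S : Graph
  S = subdivide G A

  SV : Set
  SV = V ⊎ Fin m

  pattern orig a = inj₁ a
  pattern mid k = inj₂ k

  ι : SV → Fin (n S)
  ι = join (n G) m

  ι-injective : ∀ {s t} → ι s ≡ ι t → s ≡ t
  ι-injective {s} {t} eq =
    trans (sym (Fin.splitAt-join (n G) m s)) (trans (cong (splitAt (n G)) eq) (Fin.splitAt-join (n G) m t))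

  ∈N-ι : ∀ {D v} → InN[ S ] D v → v ∈ₛ D ⊎ Σ SV (λ t → ι t ∈ₛ D × Adj S (ι t) v)
  ∈N-ι         (inj₁ v∈D)            = inj₁ v∈D
  ∈N-ι {D} {v} (inj₂ (u , u∈D , u~v)) = inj₂ (splitAt (n G) u , subst (_∈ₛ D) (sym ι∘splitAt) u∈D
                                                               , subst (λ w → Adj S w v) (sym ι∘splitAt) u~v)
    where
    ι∘splitAt : ι (splitAt (n G) u) ≡ u
    ι∘splitAt = Fin.join-splitAt (n G) m u

  end₀ end₁ : Fin m → V
  end₀ k = proj₁ (lookup A k)
  end₁ k = proj₂ (lookup A k)

  Ends : Fin m → V → Set
  Ends k a = a ≡ end₀ k ⊎ a ≡ end₁ k

  Unsubdivided : V → V → Set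
  Unsubdivided a b = (a , b) ∈ edges G × (a , b) ∉ A

  Plain : V → V → Set
  Plain a b = Unsubdivided a b ⊎ Unsubdivided b a

  Ends? : ∀ k a → Dec (Ends k a)
  Ends? k a = (a Fin.≟ end₀ k) ⊎-dec (a Fin.≟ end₁ k)

  ends-cases : ∀ {k a b c} → Ends k a → Ends k b → Ends k c → b ≢ c → a ≡ b ⊎ a ≡ c
  ends-cases (inj₁ refl) (inj₁ refl) _           _   = inj₁ refl
  ends-cases (inj₁ refl) (inj₂ refl) (inj₁ refl) _   = inj₂ refl
  ends-cases (inj₁ refl) (inj₂ refl) (inj₂ refl) b≢c = ⊥-elim (b≢c refl)
  ends-cases (inj₂ refl) _           (inj₂ refl) _   = inj₂ refl
  ends-cases (inj₂ refl) (inj₂ refl) (inj₁ refl) _   = inj₁ refl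
  ends-cases (inj₂ refl) (inj₁ refl) (inj₁ refl) b≢c = ⊥-elim (b≢c refl)

  Plain-sym : ∀ {a b} → Plain a b → Plain b a
  Plain-sym = Sum.swap

  Plain⇒Adj : ∀ {a b} → Plain a b → Adj G a b
  Plain⇒Adj = Sum.map proj₁ proj₁

  Plain? : ∀ a b → Dec (Plain a b)
  Plain? a b = unsubdivided? a b ⊎-dec unsubdivided? b a
    where
    unsubdivided? : ∀ a b → Dec (Unsubdivided a b)
    unsubdivided? a b = ((a , b) ∈? edges G) ×-dec ¬? ((a , b) ∈? A)

  adjacent⇒plain-or-subdivided : ∀ {a b} → Adj G a b → Plain a b ⊎ Σ (Fin m) (λ k → Ends k a × Ends k b)
  adjacent⇒plain-or-subdivided {a} {b} (inj₁ ab∈E) with (a , b) ∈? A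
  ... | no  ab∉A = inj₁ (inj₁ (ab∈E , ab∉A))
  ... | yes ab∈A = inj₂ (Any.index ab∈A , inj₁ (cong proj₁ ab≡) , inj₂ (cong proj₂ ab≡))
    where ab≡ = Any.lookup-index ab∈A
  adjacent⇒plain-or-subdivided {a} {b} (inj₂ ba∈E) with (b , a) ∈? A
  ... | no  ba∉A = inj₁ (inj₂ (ba∈E , ba∉A))
  ... | yes ba∈A = inj₂ (Any.index ba∈A , inj₂ (cong proj₂ ba≡) , inj₁ (cong proj₁ ba≡))
    where ba≡ = Any.lookup-index ba∈A

  data SEdge : SV → SV → Set where
    kept : ∀ {a b} → Unsubdivided a b → SEdge (orig a) (orig b)
    half : ∀ {k a} → Ends k a → SEdge (orig a) (mid k)

  private
    ι² : Edge G → Fin (n S) × Fin (n S)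
    ι² (a , b) = ι (orig a) , ι (orig b)

    kept-edges : List (Fin (n S) × Fin (n S))
    kept-edges = map ι² (filter (λ e → ¬? (e ∈? A)) (edges G))

    new-edges : Fin m → List (Fin (n S) × Fin (n S))
    new-edges k = (ι (orig (end₀ k)) , ι (mid k)) ∷ (ι (orig (end₁ k)) , ι (mid k)) ∷ []

  SEdge⇒∈ : ∀ {s t} → SEdge s t → (ι s , ι t) ∈ edges S
  SEdge⇒∈ (kept (ab∈E , ab∉A)) =
    ∈.∈-++⁺ˡ (∈.∈-map⁺ ι² (∈.∈-filter⁺ (λ e → ¬? (e ∈? A)) ab∈E ab∉A))
  SEdge⇒∈ (half {k} a∈k) =
    ∈.∈-++⁺ʳ kept-edges (∈.∈-concatMap⁺ new-edges (lose (∈.∈-allFin k) (∈-new a∈k)))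
    where
    ∈-new : ∀ {a} → Ends k a → (ι (orig a) , ι (mid k)) ∈ new-edges k
    ∈-new (inj₁ refl) = here refl
    ∈-new (inj₂ refl) = there (here refl)

  ∈⇒SEdge : ∀ {s t} → (ι s , ι t) ∈ edges S → SEdge s t
  ∈⇒SEdge {s} {t} st∈ with ∈.∈-++⁻ kept-edges st∈
  ... | inj₁ st∈kept with ∈.∈-map⁻ ι² st∈kept
  ...   | (a , b) , ab∈ , eq with ∈.∈-filter⁻ (λ e → ¬? (e ∈? A)) {xs = edges G} ab∈
                                | ι-injective {s} {orig a} (cong proj₁ eq) | ι-injective {t} {orig b} (cong proj₂ eq)
  ...     | ab∈E , ab∉A | refl | refl = kept (ab∈E , ab∉A)
  ∈⇒SEdge {s} {t} st∈ | inj₂ st∈new with Any.satisfied (∈.∈-concatMap⁻ new-edges {xs = allFin m} st∈new)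
  ... | k , here eq with ι-injective {s} {orig (end₀ k)} (cong proj₁ eq) | ι-injective {t} {mid k} (cong proj₂ eq)
  ...   | refl | refl = half (inj₁ refl)
  ∈⇒SEdge {s} {t} st∈ | inj₂ _ | k , there (here eq)
    with ι-injective {s} {orig (end₁ k)} (cong proj₁ eq) | ι-injective {t} {mid k} (cong proj₂ eq)
  ...   | refl | refl = half (inj₂ refl)

  plain⇒adj : ∀ {a b} → Plain a b → Adj S (ι (orig a)) (ι (orig b))
  plain⇒adj (inj₁ ab) = inj₁ (SEdge⇒∈ (kept ab))
  plain⇒adj (inj₂ ba) = inj₂ (SEdge⇒∈ (kept ba))

  end⇒adj : ∀ {k a} → Ends k a → Adj S (ι (orig a)) (ι (mid k))
  end⇒adj a∈k = inj₁ (SEdge⇒∈ (half a∈k))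

  adj⇒plain : ∀ {a b} → Adj S (ι (orig a)) (ι (orig b)) → Plain a b
  adj⇒plain {a} {b} (inj₁ e) with ∈⇒SEdge {orig a} {orig b} e
  ... | kept ab = inj₁ ab
  adj⇒plain {a} {b} (inj₂ e) with ∈⇒SEdge {orig b} {orig a} e
  ... | kept ba = inj₂ ba

  adj⇒end : ∀ {k a} → Adj S (ι (mid k)) (ι (orig a)) → Ends k a
  adj⇒end {k} {a} (inj₁ e) with ∈⇒SEdge {mid k} {orig a} e
  ... | ()
  adj⇒end {k} {a} (inj₂ e) with ∈⇒SEdge {orig a} {mid k} e
  ... | half a∈k = a∈k

  ¬adj-mid-mid : ∀ {j k} → ¬ Adj S (ι (mid j)) (ι (mid k))
  ¬adj-mid-mid {j} {k} (inj₁ e) with ∈⇒SEdge {mid j} {mid k} e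
  ... | ()
  ¬adj-mid-mid {j} {k} (inj₂ e) with ∈⇒SEdge {mid k} {mid j} e
  ... | ()

module Shrinking (G : Graph) (sg : SimpleGraph G) (A : List (Edge G)) (A-unique : Unique A)
                 (A⊆E : All (_∈ edges G) A) (almost-all : length (edges G) ≤ length A + 1)
                 (D : Subset (n (subdivide G A))) (D-isolating : Isolating (subdivide G A) D) where
  open GraphTheory G
  open Subdivision G A

  end∈E : ∀ k → (end₀ k , end₁ k) ∈ edges G
  end∈E k = All.lookup A⊆E (∈.∈-lookup k)

  end₀≢end₁ : ∀ k → end₀ k ≢ end₁ k
  end₀≢end₁ k = Adj-irrefl sg (inj₁ (end∈E k))

  ends-near : ∀ {k a b} → Ends k a → Ends k b → b ∈N[ a ]
  ends-near     (inj₁ refl) (inj₁ refl) = inj₁ refl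
  ends-near {k} (inj₁ refl) (inj₂ refl) = inj₂ (inj₁ (end∈E k))
  ends-near {k} (inj₂ refl) (inj₁ refl) = inj₂ (inj₂ (end∈E k))
  ends-near     (inj₂ refl) (inj₂ refl) = inj₁ refl

  -- Two distinct unsubdivided edges together with A would make |A| + 2 distinct edges of G.
  unsubdivided-unique : ∀ {a b c d} → Unsubdivided a b → Unsubdivided c d → (a , b) ≡ (c , d)
  unsubdivided-unique {a} {b} {c} {d} (ab∈E , ab∉A) (cd∈E , cd∉A) with ≡-dec Fin._≟_ Fin._≟_ (a , b) (c , d)
  ... | yes ab≡cd = ab≡cd
  ... | no  ab≢cd =
    ⊥-elim (ℕ.<-irrefl refl (subst (suc (suc m) ≤_) (ℕ.+-comm m 1) (ℕ.≤-trans too-many almost-all)))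
    where
    outside-A : ∀ {e} → e ∉ A → All (e ≢_) A
    outside-A e∉A = All.tabulate λ e′∈A e≡e′ → e∉A (subst (_∈ A) (sym e≡e′) e′∈A)
    too-many : suc (suc m) ≤ length (edges G)
    too-many = Unique∧⊆⇒length≤ ((ab≢cd ∷ outside-A ab∉A) ∷ outside-A cd∉A ∷ A-unique) (ab∈E ∷ cd∈E ∷ A⊆E)

  plain-unique : ∀ {a b c d} → Plain a b → Plain c d → (a ≡ c × b ≡ d) ⊎ (a ≡ d × b ≡ c)
  plain-unique (inj₁ ab) (inj₁ cd) with unsubdivided-unique ab cd
  ... | refl = inj₁ (refl , refl)
  plain-unique (inj₁ ab) (inj₂ dc) with unsubdivided-unique ab dc
  ... | refl = inj₂ (refl , refl)
  plain-unique (inj₂ ba) (inj₁ cd) with unsubdivided-unique ba cd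
  ... | refl = inj₂ (refl , refl)
  plain-unique (inj₂ ba) (inj₂ dc) with unsubdivided-unique ba dc
  ... | refl = inj₁ (refl , refl)

  plain-through : ∀ {a z b c} → Plain a z → Plain b c → b ≡ z ⊎ c ≡ z
  plain-through az bc with plain-unique az bc
  ... | inj₁ (_ , z≡c) = inj₂ (sym z≡c)
  ... | inj₂ (_ , z≡b) = inj₁ (sym z≡b)

  plain-partner : ∀ {a b q} → Plain a b → Plain q a → q ≡ b
  plain-partner ab qa with plain-unique qa ab
  ... | inj₁ (refl , a≡b) = ⊥-elim (Adj-irrefl sg (Plain⇒Adj ab) a≡b)
  ... | inj₂ (q≡b , _)    = q≡b


  InD : SV → Set
  InD s = ι s ∈ₛ D

  InD? : ∀ s → Dec (InD s)
  InD? s = ι s Subset.∈? D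

  Shadow : SV → V → Set
  Shadow (orig v) a = v ≡ a
  Shadow (mid k)  a = Ends k a

  Touched : V → Set
  Touched a = Σ SV λ u → InD u × Shadow u a

  Dominated : V → Set
  Dominated a = Touched a ⊎ Σ V λ q → InD (orig q) × Plain q a

  touched? : ∀ a → Dec (Touched a)
  touched? a with InD? (orig a) | Fin.any? (λ j → InD? (mid j) ×-dec Ends? j a)
  ... | yes a∈D | _                    = yes (orig a , a∈D , refl)
  ... | no _    | yes (j , j∈D , a∈j) = yes (mid j , j∈D , a∈j)
  ... | no a∉D  | no none              = no λ { (orig a , a∈D , refl) → a∉D a∈D
                                             ; (mid j , j∈D , a∈j)   → none (j , j∈D , a∈j) }

  dominated? : ∀ a → Dec (Dominated a)
  dominated? a = touched? a ⊎-dec Fin.any? (λ q → InD? (orig q) ×-dec Plain? q a)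

  ∈N⇒dominated : ∀ {a} → InN[ S ] D (ι (orig a)) → Dominated a
  ∈N⇒dominated n with ∈N-ι n
  ... | inj₁ a∈D                     = inj₁ (orig _ , a∈D , refl)
  ... | inj₂ (orig q , q∈D , q~a)    = inj₂ (q , q∈D , adj⇒plain q~a)
  ... | inj₂ (mid k  , k∈D , k~a)    = inj₁ (mid k , k∈D , adj⇒end k~a)

  ∈N-mid : ∀ {k} → InN[ S ] D (ι (mid k)) → InD (mid k) ⊎ Σ V λ b → InD (orig b) × Ends k b
  ∈N-mid n with ∈N-ι n
  ... | inj₁ k∈D                  = inj₁ k∈D
  ... | inj₂ (orig b , b∈D , b~k) = inj₂ (b , b∈D , adj⇒end (GraphTheory.Adj-sym S b~k))
  ... | inj₂ (mid j  , _ , j~k)   = ⊥-elim (¬adj-mid-mid j~k)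

  plain-edge-isolated : ∀ {a b} → Plain a b → Dominated a ⊎ Dominated b
  plain-edge-isolated ab = Sum.map ∈N⇒dominated ∈N⇒dominated (D-isolating _ _ (plain⇒adj ab))

  subdivided-edge-isolated : ∀ {k a b} → Ends k a → Ends k b → a ≢ b →
                             Dominated a ⊎ InD (mid k) ⊎ InD (orig b)
  subdivided-edge-isolated a∈k b∈k a≢b with D-isolating _ _ (end⇒adj a∈k)
  ... | inj₁ n = inj₁ (∈N⇒dominated n)
  ... | inj₂ n with ∈N-mid n
  ...   | inj₁ k∈D = inj₂ (inj₁ k∈D)
  ...   | inj₂ (c , c∈D , c∈k) with ends-cases c∈k a∈k b∈k a≢b
  ...     | inj₁ refl = inj₁ (inj₁ (orig c , c∈D , refl))
  ...     | inj₂ refl = inj₂ (inj₂ c∈D)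

  plain-edge-touched : ∀ {a b} → Plain a b → Touched a ⊎ Touched b
  plain-edge-touched ab with plain-edge-isolated ab
  ... | inj₁ (inj₁ a-touched)      = inj₁ a-touched
  ... | inj₁ (inj₂ (q , q∈D , qa)) = inj₂ (orig q , q∈D , plain-partner ab qa)
  ... | inj₂ (inj₁ b-touched)      = inj₂ b-touched
  ... | inj₂ (inj₂ (q , q∈D , qb)) = inj₁ (orig q , q∈D , plain-partner (Plain-sym ab) qb)

  subdivided-edge-touched : ∀ {k a b} → Ends k a → Ends k b → a ≢ b → Touched a ⊎ Touched b
  subdivided-edge-touched a∈k b∈k a≢b with subdivided-edge-isolated a∈k b∈k a≢b
  ... | inj₂ (inj₁ k∈D)            = inj₁ (mid _ , k∈D , a∈k)
  ... | inj₂ (inj₂ b∈D)            = inj₂ (orig _ , b∈D , refl)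
  ... | inj₁ (inj₁ a-touched)      = inj₁ a-touched
  ... | inj₁ (inj₂ (q , q∈D , qa)) with subdivided-edge-isolated b∈k a∈k (a≢b ∘ sym)
  ...   | inj₂ (inj₁ k∈D)          = inj₂ (mid _ , k∈D , b∈k)
  ...   | inj₂ (inj₂ a∈D)          = inj₁ (orig _ , a∈D , refl)
  ...   | inj₁ (inj₁ b-touched)    = inj₂ b-touched
  ...   | inj₁ (inj₂ (_ , _ , q′b)) with plain-unique qa q′b
  ...     | inj₁ (_ , a≡b)         = ⊥-elim (a≢b a≡b)
  ...     | inj₂ (q≡b , _)         = inj₂ (orig q , q∈D , q≡b)

  touched-cover : ∀ {a b} → Adj G a b → Touched a ⊎ Touched b
  touched-cover a~b with adjacent⇒plain-or-subdivided a~b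
  ... | inj₁ ab              = plain-edge-touched ab
  ... | inj₂ (_ , a∈k , b∈k) = subdivided-edge-touched a∈k b∈k (Adj-irrefl sg a~b)

  IsolatesAt : Subset (n G) → V → Set
  IsolatesAt D′ a = InN[ G ] D′ a ⊎ (∀ {u} → Adj G a u → InN[ G ] D′ u)

  _≟ₛ_ : (s t : SV) → Dec (s ≡ t)
  _≟ₛ_ = Sum.≡-dec Fin._≟_ Fin._≟_

  default : SV → V
  default (orig a) = a
  default (mid k)  = end₀ k

  shadow-near-default : ∀ {u a} → Shadow u a → a ∈N[ default u ]
  shadow-near-default {orig _} v≡a = inj₁ v≡a
  shadow-near-default {mid _}  a∈k = ends-near (inj₁ refl) a∈k

  redirect : SV → V → SV → V
  redirect s t u with u ≟ₛ s
  ... | yes _ = t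
  ... | no  _ = default u

  redirect-moved : ∀ s t → redirect s t s ≡ t
  redirect-moved s t with s ≟ₛ s
  ... | yes _   = refl
  ... | no  s≢s = ⊥-elim (s≢s refl)

  redirect-other : ∀ {s t u} → u ≢ s → redirect s t u ≡ default u
  redirect-other {s} {u = u} u≢s with u ≟ₛ s
  ... | yes u≡s = ⊥-elim (u≢s u≡s)
  ... | no  _   = refl

  projection : SV → SV → V → Subset (n G)
  projection d s t = image (redirect s t ∘ splitAt (n G)) (D - ι d)

  -- Drop d from D and project the rest to G, sending s to t: one vertex is lost, and the result
  -- isolates G as soon as t dominates the shadow of s and the edges at the shadow of d are isolated.
  data Exchange : Set where
    exchange : ∀ {d s t} → InD d → InD s → s ≢ d → (∀ {a} → Shadow s a → a ∈N[ t ]) →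
               (∀ {a} → Shadow d a → IsolatesAt (projection d s t) a) → Exchange

  module Projection {d s : SV} {t : V} (s∈D : InD s) (s≢d : s ≢ d)
                    (covers : ∀ {a} → Shadow s a → a ∈N[ t ]) where

    D′ : Subset (n G)
    D′ = projection d s t

    redirect∈D′ : ∀ {u} → InD u → u ≢ d → redirect s t u ∈ₛ D′
    redirect∈D′ {u} u∈D u≢d =
      subst (_∈ₛ D′) (cong (redirect s t) (Fin.splitAt-join (n G) m u))
        (∈image (redirect s t ∘ splitAt (n G)) (D - ι d) (Subset.x∈p∧x≢y⇒x∈p-y u∈D (u≢d ∘ ι-injective)))

    near-redirect : ∀ {u a} → InD u → u ≢ d → a ∈N[ redirect s t u ] → InN[ G ] D′ a
    near-redirect u∈D u≢d (inj₁ refl) = inj₁ (redirect∈D′ u∈D u≢d)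
    near-redirect u∈D u≢d (inj₂ r~a)  = inj₂ (_ , redirect∈D′ u∈D u≢d , r~a)

    near-target : ∀ {a} → a ∈N[ t ] → InN[ G ] D′ a
    near-target {a} a∈N = near-redirect s∈D s≢d (subst (a ∈N[_]) (sym (redirect-moved s t)) a∈N)

    near-default : ∀ {u a} → InD u → u ≢ d → u ≢ s → a ∈N[ default u ] → InN[ G ] D′ a
    near-default {a = a} u∈D u≢d u≢s a∈N = near-redirect u∈D u≢d (subst (a ∈N[_]) (sym (redirect-other u≢s)) a∈N)

    shadow-covered : ∀ {u a} → InD u → u ≢ d → Shadow u a → InN[ G ] D′ a
    shadow-covered {u} u∈D u≢d sh with u ≟ₛ s
    ... | yes refl = near-target (covers sh)
    ... | no  u≢s  = near-default u∈D u≢d u≢s (shadow-near-default sh)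

  exchange⇒smaller : Exchange → Σ (Subset (n G)) λ D′ → Isolating G D′ × ∣ D′ ∣ < ∣ D ∣
  exchange⇒smaller (exchange {d} {s} {t} d∈D s∈D s≢d covers d-isolated) = D′ , isolating , smaller
    where
    open Projection s∈D s≢d covers

    touched-isolated : ∀ {a} → Touched a → IsolatesAt D′ a
    touched-isolated (u , u∈D , sh) with u ≟ₛ d
    ... | yes refl = d-isolated sh
    ... | no  u≢d  = inj₁ (shadow-covered u∈D u≢d sh)

    isolating : Isolating G D′
    isolating a b a~b with touched-cover a~b
    ... | inj₁ a-touched = Sum.map₂ (λ nbrs → nbrs a~b) (touched-isolated a-touched)
    ... | inj₂ b-touched = Sum.swap (Sum.map₂ (λ nbrs → nbrs (Adj-sym a~b)) (touched-isolated b-touched))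

    smaller : ∣ D′ ∣ < ∣ D ∣
    smaller = ℕ.≤-<-trans (∣image∣≤ (redirect s t ∘ splitAt (n G)) (D - ι d)) (Subset.x∈p⇒∣p-x∣<∣p∣ d∈D)

  merge : ∀ {d s t} → InD d → InD s → s ≢ d →
          (∀ {a} → Shadow d a → a ∈N[ t ]) → (∀ {a} → Shadow s a → a ∈N[ t ]) → Exchange
  merge d∈D s∈D s≢d d-near s-near = exchange d∈D s∈D s≢d s-near (inj₁ ∘ near-target ∘ d-near)
    where open Projection s∈D s≢d s-near

  Private : Fin m → V → Set
  Private k x = ¬ InD (orig x) × (∀ {j} → InD (mid j) → Ends j x → j ≡ k)

  Exposed : Fin m → V → Set
  Exposed k x = InD (orig x) ⊎ Σ (Fin m) λ j → InD (mid j) × Ends j x × j ≢ k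

  exposed-or-private : ∀ k x → Exposed k x ⊎ Private k x
  exposed-or-private k x with InD? (orig x) | Fin.any? (λ j → InD? (mid j) ×-dec Ends? j x ×-dec ¬? (j Fin.≟ k))
  ... | yes x∈D | _          = inj₁ (inj₁ x∈D)
  ... | no _    | yes (j , p) = inj₁ (inj₂ (j , p))
  ... | no x∉D  | no none     =
    inj₂ (x∉D , λ {j} j∈D x∈j → decidable-stable (j Fin.≟ k) (λ j≢k → none (j , j∈D , x∈j , j≢k)))

  exposed⇒exchange : ∀ {k x} → InD (mid k) → Ends k x → Exposed k x → Exchange
  exposed⇒exchange {x = x} k∈D x∈k (inj₁ x∈D) =
    merge {s = orig x} k∈D x∈D (λ ()) (ends-near x∈k) (λ { refl → inj₁ refl })
  exposed⇒exchange k∈D x∈k (inj₂ (j , j∈D , x∈j , j≢k)) =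
    merge k∈D j∈D (j≢k ∘ Sum.inj₂-injective) (ends-near x∈k) (ends-near x∈j)

  private-neighbour-dominated : ∀ {k x r} → Private k x → Adj G x r → ¬ Plain x r → ¬ Ends k r → Dominated r
  private-neighbour-dominated {r = r} (x∉D , only-k) x~r ¬xr r∉k with adjacent⇒plain-or-subdivided x~r
  ... | inj₁ xr = ⊥-elim (¬xr xr)
  ... | inj₂ (j , x∈j , r∈j) with subdivided-edge-isolated r∈j x∈j (Adj-irrefl sg x~r ∘ sym)
  ...   | inj₁ r-dominated = r-dominated
  ...   | inj₂ (inj₁ j∈D)  = ⊥-elim (r∉k (subst (λ i → Ends i r) (only-k j∈D x∈j) r∈j))
  ...   | inj₂ (inj₂ x∈D)  = ⊥-elim (x∉D x∈D)

  private-neighbour-plain : ∀ {k x r} → Private k x → Adj G x r → ¬ Ends k r → ¬ Dominated r → Plain x r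
  private-neighbour-plain {x = x} {r} px x~r r∉k r-undominated =
    decidable-stable (Plain? x r) (λ ¬xr → r-undominated (private-neighbour-dominated px x~r ¬xr r∉k))

  module ProjectionFromMid {j : Fin m} {s : SV} {t : V} (s∈D : InD s) (s≢j : s ≢ mid j)
                           (covers : ∀ {a} → Shadow s a → a ∈N[ t ]) where
    open Projection s∈D s≢j covers public

    dominated-covered : ∀ {a} → Dominated a → ¬ Ends j a →
                        (∀ {q} → s ≡ orig q → Plain q a → a ∈N[ t ]) → InN[ G ] D′ a
    dominated-covered (inj₁ (u , u∈D , sh)) a∉j _ = shadow-covered u∈D (λ { refl → a∉j sh }) sh
    dominated-covered (inj₂ (q , q∈D , qa)) _ moved with orig q ≟ₛ s
    ... | yes q≡s = near-target (moved (sym q≡s) qa)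
    ... | no  q≢s = near-default q∈D (λ ()) q≢s (inj₂ (Plain⇒Adj qa))

    private-end-isolated : ∀ {x y} → Ends j x → Ends j y → x ≢ y → Private j x → y ∈N[ t ] →
                           (∀ {q a} → s ≡ orig q → Plain q a → a ∈N[ t ]) →
                           (∀ {u} → Plain x u → u ≢ y → u ∈N[ t ]) → IsolatesAt D′ x
    private-end-isolated {x} {y} x∈j y∈j x≢y px y-near moved plain-near = inj₂ neighbour-covered
      where
      neighbour-covered : ∀ {u} → Adj G x u → InN[ G ] D′ u
      neighbour-covered {u} x~u with u Fin.≟ y
      ... | yes refl = near-target y-near
      ... | no  u≢y with Plain? x u
      ...   | yes xu  = near-target (plain-near xu u≢y)
      ...   | no  ¬xu = dominated-covered (private-neighbour-dominated px x~u ¬xu u∉j) u∉j moved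
        where
        u∉j : ¬ Ends j u
        u∉j u∈j = [ Adj-irrefl sg x~u ∘ sym , u≢y ] (ends-cases u∈j x∈j y∈j x≢y)

  module _ (conn : Connected G) (not-star : ¬ IsStar G) where

    exchange-without-mid : (∀ k → ¬ InD (mid k)) → Exchange
    exchange-without-mid no-mid with shared?
      where
      shared? = Fin.any? λ x₁ → Fin.any? λ x₂ → Fin.any? λ y →
        InD? (orig x₁) ×-dec InD? (orig x₂) ×-dec ¬? (x₁ Fin.≟ x₂) ×-dec x₁ ∈N?[ y ] ×-dec x₂ ∈N?[ y ]
    ... | yes (x₁ , x₂ , y , x₁∈D , x₂∈D , x₁≢x₂ , x₁∈N , x₂∈N) =
      merge x₁∈D x₂∈D (x₁≢x₂ ∘ sym ∘ Sum.inj₁-injective) (λ { refl → x₁∈N }) (λ { refl → x₂∈N })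
    ... | no none =
      ⊥-elim (not-star (star-of-packing-vertex-cover sg conn (InD ∘ orig) (InD? ∘ orig) cover packing))
      where
      in-original : ∀ {a} → Touched a → InD (orig a)
      in-original (orig _ , a∈D , refl) = a∈D
      in-original (mid k  , k∈D , _)    = ⊥-elim (no-mid k k∈D)

      cover : ∀ {a b} → Adj G a b → InD (orig a) ⊎ InD (orig b)
      cover = Sum.map in-original in-original ∘ touched-cover

      packing : ∀ {x₁ x₂ y} → InD (orig x₁) → InD (orig x₂) → x₁ ∈N[ y ] → x₂ ∈N[ y ] → x₁ ≡ x₂
      packing {x₁} {x₂} {y} x₁∈D x₂∈D x₁∈N x₂∈N =
        decidable-stable (x₁ Fin.≟ x₂) λ x₁≢x₂ → none (x₁ , x₂ , y , x₁∈D , x₂∈D , x₁≢x₂ , x₁∈N , x₂∈N)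

    module BothPrivate {k : Fin m} (k∈D : InD (mid k)) {x y : V} (x∈k : Ends k x) (y∈k : Ends k y)
                       (x≢y : x ≢ y) (px : Private k x) (py : Private k y) where

      not-end : ∀ {z} → z ≢ x → z ≢ y → ¬ Ends k z
      not-end z≢x z≢y z∈k = [ z≢x , z≢y ] (ends-cases z∈k x∈k y∈k x≢y)

      drop-k : ∀ {s t} → InD s → s ≢ mid k → (∀ {a} → Shadow s a → a ∈N[ t ]) → y ∈N[ t ] →
               (∀ {q a} → s ≡ orig q → Plain q a → a ∈N[ t ]) →
               (∀ {u} → Plain x u → u ≢ y → u ∈N[ t ]) → Exchange
      drop-k s∈D s≢k covers y-near moved plain-near = exchange k∈D s∈D s≢k covers isolated
        where
        open ProjectionFromMid s∈D s≢k covers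
        isolated : ∀ {a} → Ends k a → IsolatesAt D′ a
        isolated a∈k with ends-cases a∈k x∈k y∈k x≢y
        ... | inj₁ refl = private-end-isolated x∈k y∈k x≢y px y-near moved plain-near
        ... | inj₂ refl = inj₁ (near-target y-near)

      drop-k-redirect-orig : ∀ {v z} → InD (orig v) → Adj G v z → z ≢ x → Adj G y z →
                             (∀ {a b} → Plain a b → a ≡ z ⊎ b ≡ z) → Exchange
      drop-k-redirect-orig {v} {z} v∈D v~z z≢x y~z through-z =
        drop-k v∈D (λ ()) (λ { refl → inj₂ (Adj-sym v~z) }) (inj₂ (Adj-sym y~z)) moved plain-near
        where
        moved : ∀ {q a} → orig v ≡ orig q → Plain q a → a ∈N[ z ]
        moved refl qa with through-z qa
        ... | inj₁ v≡z = ⊥-elim (Adj-irrefl sg v~z v≡z)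
        ... | inj₂ a≡z = inj₁ (sym a≡z)
        plain-near : ∀ {u} → Plain x u → u ≢ y → u ∈N[ z ]
        plain-near xu _ with through-z xu
        ... | inj₁ x≡z = ⊥-elim (z≢x (sym x≡z))
        ... | inj₂ u≡z = inj₁ (sym u≡z)

      drop-k-redirect-mid : ∀ {j z} → InD (mid j) → Ends j z → z ≢ x → z ≢ y → Adj G y z →
                            (∀ {p} → ¬ Plain x p) → Exchange
      drop-k-redirect-mid j∈D z∈j z≢x z≢y y~z x-unplain =
        drop-k j∈D j≢k (ends-near z∈j) (inj₂ (Adj-sym y~z)) (λ ()) (λ xu _ → ⊥-elim (x-unplain xu))
        where
        j≢k : mid _ ≢ mid k
        j≢k refl = not-end z≢x z≢y z∈j

      drop-mid-redirect-k : ∀ {j z p} → InD (mid j) → Ends j z → z ≢ x → z ≢ y → Adj G y z →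
                            Plain x p → Exchange
      drop-mid-redirect-k {j} {z} j∈D z∈j z≢x z≢y y~z xp = exchange j∈D k∈D k≢j (ends-near y∈k) isolated
        where
        k≢j : mid k ≢ mid j
        k≢j refl = not-end z≢x z≢y z∈j
        open ProjectionFromMid k∈D k≢j (ends-near y∈k)

        isolated : ∀ {a} → Ends j a → IsolatesAt D′ a
        isolated {a} a∈j with a Fin.≟ z
        ... | yes refl = inj₁ (near-target (inj₂ y~z))
        ... | no  a≢z with exposed-or-private j a
        ...   | inj₁ (inj₁ a∈D)                   = inj₁ (shadow-covered a∈D (λ ()) refl)
        ...   | inj₁ (inj₂ (i , i∈D , a∈i , i≢j)) = inj₁ (shadow-covered i∈D (i≢j ∘ Sum.inj₂-injective) a∈i)
        ...   | inj₂ pa = private-end-isolated a∈j z∈j a≢z pa (inj₂ y~z) (λ ()) plain-near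
          where
          plain-near : ∀ {u} → Plain a u → u ≢ z → u ∈N[ y ]
          plain-near au _ with plain-unique au xp
          ... | inj₁ (refl , _)    = ⊥-elim (k≢j (cong mid (sym (proj₂ px j∈D a∈j))))
          ... | inj₂ (refl , refl) = ends-near y∈k x∈k

      dominated-neighbour⇒exchange : ∀ {z} → z ≢ x → z ≢ y → Adj G y z → Dominated z → Exchange
      dominated-neighbour⇒exchange z≢x z≢y y~z (inj₁ (orig z , z∈D , refl)) =
        merge {d = orig z} z∈D k∈D (λ ()) (λ { refl → inj₂ y~z }) (ends-near y∈k)
      dominated-neighbour⇒exchange z≢x z≢y y~z (inj₁ (mid j , j∈D , z∈j)) with Fin.any? (Plain? x)
      ... | yes (_ , xp) = drop-mid-redirect-k j∈D z∈j z≢x z≢y y~z xp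
      ... | no  none     = drop-k-redirect-mid j∈D z∈j z≢x z≢y y~z (λ xp → none (_ , xp))
      dominated-neighbour⇒exchange z≢x z≢y y~z (inj₂ (q , q∈D , qz)) =
        drop-k-redirect-orig q∈D (Plain⇒Adj qz) z≢x y~z (plain-through qz)

      module NoDominatedOutsideNeighbour {z : V} (z≢x : z ≢ x) (z≢y : z ≢ y) (y~z : Adj G y z)
               (undominated : ∀ {r} → r ≢ x → r ≢ y → Adj G x r ⊎ Adj G y r → ¬ Dominated r) where

        plain-from-x : ∀ {r} → Adj G x r → r ≢ y → Plain x r
        plain-from-x x~r r≢y = private-neighbour-plain px x~r (not-end r≢x r≢y) (undominated r≢x r≢y (inj₁ x~r))
          where r≢x = Adj-irrefl sg x~r ∘ sym

        plain-from-y : ∀ {r} → Adj G y r → r ≢ x → Plain y r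
        plain-from-y y~r r≢x = private-neighbour-plain py y~r (not-end r≢x r≢y) (undominated r≢x r≢y (inj₂ y~r))
          where r≢y = Adj-irrefl sg y~r ∘ sym

        yz : Plain y z
        yz = plain-from-y y~z z≢x

        z-neighbour∈D : ∀ {v} → v ≢ y → Adj G z v → InD (orig v)
        z-neighbour∈D v≢y z~v with adjacent⇒plain-or-subdivided z~v
        ... | inj₁ zv with plain-unique zv yz
        ...   | inj₁ (z≡y , _) = ⊥-elim (z≢y z≡y)
        ...   | inj₂ (_ , v≡y) = ⊥-elim (v≢y v≡y)
        z-neighbour∈D v≢y z~v | inj₂ (j , z∈j , v∈j) with subdivided-edge-isolated z∈j v∈j (Adj-irrefl sg z~v)
        ... | inj₁ z-dominated = ⊥-elim (undominated z≢x z≢y (inj₂ y~z) z-dominated)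
        ... | inj₂ (inj₁ j∈D)  = ⊥-elim (undominated z≢x z≢y (inj₂ y~z) (inj₁ (mid j , j∈D , z∈j)))
        ... | inj₂ (inj₂ v∈D)  = v∈D

        x-leaf : ∀ {r} → Adj G x r → r ≡ y
        x-leaf {r} x~r = decidable-stable (r Fin.≟ y) λ r≢y →
          [ x≢y ∘ proj₁ , z≢x ∘ sym ∘ proj₁ ] (plain-unique (plain-from-x x~r r≢y) yz)

        y-neighbour : ∀ {r} → Adj G y r → r ≡ x ⊎ r ≡ z
        y-neighbour {r} y~r with r Fin.≟ x
        ... | yes r≡x = inj₁ r≡x
        ... | no  r≢x with plain-unique (plain-from-y y~r r≢x) yz
        ...   | inj₁ (_ , r≡z) = inj₂ r≡z
        ...   | inj₂ (y≡z , _) = ⊥-elim (z≢y (sym y≡z))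

        exchange-near-z : Exchange
        exchange-near-z with Fin.any? (λ v → ¬? (v Fin.≟ y) ×-dec Adj? z v)
        ... | yes (v , v≢y , z~v) =
          drop-k-redirect-orig (z-neighbour∈D v≢y z~v) (Adj-sym z~v) z≢x y~z (plain-through yz)
        ... | no  none = ⊥-elim (not-star (star-of-closed sg conn Path (inj₂ (inj₁ refl)) closed))
          where
          Path : V → Set
          Path w = w ≡ x ⊎ w ≡ y ⊎ w ≡ z

          z-leaf : ∀ {r} → Adj G z r → r ≡ y
          z-leaf {r} z~r = decidable-stable (r Fin.≟ y) λ r≢y → none (r , r≢y , z~r)

          closed : ∀ {a b} → Path a → Adj G a b → Path b × (a ≡ y ⊎ b ≡ y)
          closed (inj₁ refl)        a~b with x-leaf a~b
          ... | refl = inj₂ (inj₁ refl) , inj₂ refl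
          closed (inj₂ (inj₁ refl)) a~b = [ inj₁ , inj₂ ∘ inj₂ ] (y-neighbour a~b) , inj₁ refl
          closed (inj₂ (inj₂ refl)) a~b with z-leaf a~b
          ... | refl = inj₂ (inj₁ refl) , inj₂ refl

      no-outside-neighbour⇒star : (∀ {r} → r ≢ x → r ≢ y → ¬ (Adj G x r ⊎ Adj G y r)) → IsStar G
      no-outside-neighbour⇒star no-outside = star-of-closed sg conn Edge-xy (inj₁ refl) closed
        where
        Edge-xy : V → Set
        Edge-xy w = w ≡ x ⊎ w ≡ y

        within : ∀ {r} → Adj G x r ⊎ Adj G y r → Edge-xy r
        within {r} adj with r Fin.≟ x | r Fin.≟ y
        ... | yes r≡x | _       = inj₁ r≡x
        ... | no  _   | yes r≡y = inj₂ r≡y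
        ... | no  r≢x | no  r≢y = ⊥-elim (no-outside r≢x r≢y adj)

        closed : ∀ {a b} → Edge-xy a → Adj G a b → Edge-xy b × (a ≡ x ⊎ b ≡ x)
        closed (inj₁ refl) a~b = within (inj₁ a~b) , inj₁ refl
        closed (inj₂ refl) a~b with within (inj₂ a~b)
        ... | inj₁ b≡x = inj₁ b≡x , inj₂ b≡x
        ... | inj₂ b≡y = ⊥-elim (Adj-irrefl sg a~b (sym b≡y))

    module _ {k : Fin m} (k∈D : InD (mid k)) {x y : V} (x∈k : Ends k x) (y∈k : Ends k y) (x≢y : x ≢ y)
             (px : Private k x) (py : Private k y) where
      private
        module XY = BothPrivate k∈D x∈k y∈k x≢y px py
        module YX = BothPrivate k∈D y∈k x∈k (x≢y ∘ sym) py px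

        outside? : ∀ z → Dec (z ≢ x × z ≢ y × (Adj G x z ⊎ Adj G y z))
        outside? z = ¬? (z Fin.≟ x) ×-dec ¬? (z Fin.≟ y) ×-dec (Adj? x z ⊎-dec Adj? y z)

      both-private⇒exchange : Exchange
      both-private⇒exchange with Fin.any? (λ z → outside? z ×-dec dominated? z)
      ... | yes (z , (z≢x , z≢y , inj₁ x~z) , z-dominated) = YX.dominated-neighbour⇒exchange z≢y z≢x x~z z-dominated
      ... | yes (z , (z≢x , z≢y , inj₂ y~z) , z-dominated) = XY.dominated-neighbour⇒exchange z≢x z≢y y~z z-dominated
      ... | no none with Fin.any? outside?
      ...   | yes (z , z≢x , z≢y , inj₁ x~z) = YX.NoDominatedOutsideNeighbour.exchange-near-z z≢y z≢x x~z
                                                 λ r≢y r≢x adj r-dom → none (_ , (r≢x , r≢y , Sum.swap adj) , r-dom)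
      ...   | yes (z , z≢x , z≢y , inj₂ y~z) = XY.NoDominatedOutsideNeighbour.exchange-near-z z≢x z≢y y~z
                                                 λ r≢x r≢y adj r-dom → none (_ , (r≢x , r≢y , adj) , r-dom)
      ...   | no  no-outside =
        ⊥-elim (not-star (XY.no-outside-neighbour⇒star λ r≢x r≢y adj → no-outside (_ , r≢x , r≢y , adj)))

    exchange-exists : Exchange
    exchange-exists with Fin.any? (InD? ∘ mid)
    ... | no  none      = exchange-without-mid (λ k k∈D → none (k , k∈D))
    ... | yes (k , k∈D) with exposed-or-private k (end₀ k) | exposed-or-private k (end₁ k)
    ...   | inj₁ exposed | _           = exposed⇒exchange k∈D (inj₁ refl) exposed
    ...   | inj₂ _       | inj₁ exposed = exposed⇒exchange k∈D (inj₂ refl) exposed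
    ...   | inj₂ p₀      | inj₂ p₁      = both-private⇒exchange k∈D (inj₁ refl) (inj₂ refl) (end₀≢end₁ k) p₀ p₁

    smaller-isolating-set : Σ (Subset (n G)) λ D′ → Isolating G D′ × ∣ D′ ∣ < ∣ D ∣
    smaller-isolating-set = exchange⇒smaller exchange-exists

theorem3p6 : (G : Graph) → SimpleGraph G → Connected G → ¬ IsStar G →
    (A : List (Edge G)) → Unique A → All (_∈ edges G) A →
    length (edges G) ≤ length A + 1 →
    (i j : ℕ) → IsIsolationNumber G i → IsIsolationNumber (subdivide G A) j →
    suc i ≤ j
theorem3p6 G sg conn not-star A A-unique A⊆E almost-all i j (_ , minimal) ((D , D-isolating , refl) , _)
  with Shrinking.smaller-isolating-set G sg A A-unique A⊆E almost-all D D-isolating conn not-star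
... | D′ , D′-isolating , smaller = ℕ.≤-<-trans (minimal D′ D′-isolating) smaller
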